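{- For every integer $n \geq 1$, $f_2(n) \leq x_n$, where $(x_n)_{n\ge1}$ is the sequence defined by $x_1 = 0, x_2 = 1, x_3 = 2, x_4 = 4, x_5 = 5$ and, for $n \geq 6$, $$x_n = (n - 1) + \begin{cases} x_{\frac{n + 1}{2}} + x_{\frac{n - 3}{2}}, & n \equiv 1 \pmod 4,\\ 2 x_{\frac{n - 1}{2}}, & n \equiv 3 \pmod 4,\\ x_{\frac{n}{2}} + x_{\frac{n - 2}{2}}, & n \text{ even}. \end{cases}$$
   Context: An oriented graph is a finite directed graph with no loops, no multiple arcs and no directed cycle of length $2$. The weak diameter of an oriented graph $\overrightarrow{G}$ is the minimum $d$ such that for any two distinct vertices $u,v$ there is a directed path of length at most $d$ from $u$ to $v$ or from $v$ to $u$. For $n\ge1$, $f_2(n)$ denotes the minimum number of arcs of an oriented graph on $n$ vertices having weak diameter at most $2$. -}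

module Defs where

open import Data.Nat using (ℕ; zero; suc; _+_; _*_; _∸_; _≤_)
open import Data.Nat.DivMod using (_/_; _%_)
open import Data.Fin using (Fin)
open import Data.Product using (_×_; _,_; Σ; ∃-syntax)
open import Data.Sum using (_⊎_)
open import Data.List using (List; length)
open import Data.List.Membership.Propositional using (_∈_)
open import Data.List.Relation.Unary.Unique.Propositional using (Unique)
open import Relation.Binary.PropositionalEquality using (_≡_; _≢_)
open import Relation.Nullary using (¬_)

record OrientedGraph (n : ℕ) : Set where
  field
    arcs     : List (Fin n × Fin n)
    distinct : Unique arcs
    noLoop   : ∀ u → ¬ ((u , u) ∈ arcs)
    no2cycle : ∀ u v → (u , v) ∈ arcs → ¬ ((v , u) ∈ arcs)

open OrientedGraph public

Arc : ∀ {n} → OrientedGraph n → Fin n → Fin n → Set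
Arc G u v = (u , v) ∈ arcs G

numArcs : ∀ {n} → OrientedGraph n → ℕ
numArcs G = length (arcs G)

Reach≤2 : ∀ {n} → OrientedGraph n → Fin n → Fin n → Set
Reach≤2 G u v = Arc G u v ⊎ (∃[ w ] (Arc G u w × Arc G w v))

WeakDiam≤2 : ∀ {n} → OrientedGraph n → Set
WeakDiam≤2 G = ∀ u v → u ≢ v → Reach≤2 G u v ⊎ Reach≤2 G v u

-- The sequence x_n, computed with a fuel argument (fuel ≥ n suffices,
-- since all recursive calls are at strictly smaller indices ≥ 1).
xf : ℕ → ℕ → ℕ
xf zero    _ = 0
xf (suc k) 0 = 0
xf (suc k) 1 = 0
xf (suc k) 2 = 1
xf (suc k) 3 = 2
xf (suc k) 4 = 4
xf (suc k) 5 = 5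
xf (suc k) n with n % 4
... | 1 = (n ∸ 1) + (xf k ((n + 1) / 2) + xf k ((n ∸ 3) / 2))
... | 3 = (n ∸ 1) + 2 * xf k ((n ∸ 1) / 2)
... | _ = (n ∸ 1) + (xf k (n / 2) + xf k ((n ∸ 2) / 2))

x : ℕ → ℕ
x n = xf n n

-- Given oriented graphs G₁ on a and G₂ on b vertices of weak diameter at most 2, add a hub vertex h
-- with an arc from every vertex of G₁ to h and from h to every vertex of G₂. Pairs inside G₁ or
-- inside G₂ are handled there, a pair across goes through h, so the new graph on a + b + 1 vertices
-- has weak diameter at most 2 and |G₁| + |G₂| + a + b arcs. Splitting n − 1 into the two halves
-- prescribed by the recursion gives f₂(n) ≤ xₙ for n ≥ 6; the small cases are joins of smaller
-- graphs except n = 5, where the directed 5-cycle does better.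
module Submission where

open import Defs
open import Data.Nat using (ℕ; zero; suc; _+_; _*_; _∸_; _≤_; _<_; z≤n; s≤s; s≤s⁻¹; _/_; _%_)
open import Data.Nat.Properties
  using (≤-refl; ≤-trans; m≤m+n; m≤n+m; +-mono-≤; +-comm; +-identityʳ; *-comm; <⇒≱)
open import Data.Nat.DivMod using (m≡m%n+[m/n]*n; m*n/n≡m; m≥n⇒m/n>0; m%n<n; m∣n⇒o%n%m≡o%m)
open import Data.Nat.Divisibility using (divides)
open import Data.Fin using (Fin; zero; suc; _↑ˡ_; _↑ʳ_; splitAt; _≟_)
open import Data.Fin.Patterns using (0F; 1F; 2F; 3F; 4F)
open import Data.Fin.Properties using (splitAt-↑ˡ; splitAt-↑ʳ; join-splitAt; all?; any?)
open import Data.Maybe using (Maybe; just; nothing)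
open import Data.Maybe.Properties using (just-injective)
open import Data.Product using (_×_; _,_; Σ; ∃₂)
open import Data.Product.Properties using (≡-dec)
open import Data.Sum using (_⊎_; inj₁; inj₂)
import Data.Sum as Sum
open import Data.Sum.Properties using (inj₁-injective; inj₂-injective)
open import Data.List using (List; []; _∷_; map; _++_; length; allFin)
open import Data.List.Properties using (length-map; length-++; length-tabulate)
open import Data.List.Membership.Propositional using (_∈_)
open import Data.List.Membership.Propositional.Properties using (∈-map⁺; ∈-map⁻; ∈-++⁺ˡ; ∈-++⁺ʳ; ∈-++⁻; ∈-allFin)
open import Data.List.Relation.Unary.Unique.Propositional using (Unique)
open import Data.List.Relation.Unary.AllPairs using ([])
open import Data.List.Relation.Unary.Unique.Propositional.Properties using (map⁺; ++⁺; allFin⁺)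
import Data.List.Relation.Unary.Unique.DecPropositional as UniqueDec
import Data.List.Membership.DecPropositional as MembershipDec
open import Data.Empty using (⊥; ⊥-elim)
open import Function using (_∘_; id)
open import Function.Definitions using (Injective)
open import Relation.Nullary using (Dec; ¬_; ¬?)
open import Relation.Nullary.Decidable using (from-yes; _→-dec_; _⊎-dec_; _×-dec_)
open import Relation.Binary.PropositionalEquality
  using (_≡_; _≢_; refl; sym; trans; cong; cong₂; subst; module ≡-Reasoning)

infixr 5 _⊕_

_⊕_ : {A B : Set} → List A → List B → List (A ⊎ B)
xs ⊕ ys = map inj₁ xs ++ map inj₂ ys

length-⊕ : {A B : Set} (xs : List A) (ys : List B) → length (xs ⊕ ys) ≡ length xs + length ys
length-⊕ xs ys = trans (length-++ (map inj₁ xs)) (cong₂ _+_ (length-map inj₁ xs) (length-map inj₂ ys))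

module _ {A B : Set} {xs : List A} {ys : List B} where

  ⊕-unique : Unique xs → Unique ys → Unique (xs ⊕ ys)
  ⊕-unique xs! ys! = ++⁺ (map⁺ inj₁-injective xs!) (map⁺ inj₂-injective ys!) disjoint
    where
    disjoint : ∀ {z} → z ∈ map inj₁ xs × z ∈ map inj₂ ys → ⊥
    disjoint (z∈₁ , z∈₂) with ∈-map⁻ inj₁ z∈₁ | ∈-map⁻ inj₂ z∈₂
    ... | _ , _ , refl | _ , _ , ()

  ∈-⊕⁺ˡ : ∀ {x} → x ∈ xs → inj₁ x ∈ xs ⊕ ys
  ∈-⊕⁺ˡ x∈ = ∈-++⁺ˡ (∈-map⁺ inj₁ x∈)

  ∈-⊕⁺ʳ : ∀ {y} → y ∈ ys → inj₂ y ∈ xs ⊕ ys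
  ∈-⊕⁺ʳ y∈ = ∈-++⁺ʳ (map inj₁ xs) (∈-map⁺ inj₂ y∈)

  ∈-⊕⁻ˡ : ∀ {x} → inj₁ x ∈ xs ⊕ ys → x ∈ xs
  ∈-⊕⁻ˡ x∈ with ∈-++⁻ (map inj₁ xs) x∈
  ... | inj₁ x∈₁ with ∈-map⁻ inj₁ x∈₁
  ...   | _ , x∈xs , refl = x∈xs
  ∈-⊕⁻ˡ x∈ | inj₂ x∈₂ with ∈-map⁻ inj₂ x∈₂
  ...   | _ , _ , ()

  ∈-⊕⁻ʳ : ∀ {y} → inj₂ y ∈ xs ⊕ ys → y ∈ ys
  ∈-⊕⁻ʳ y∈ with ∈-++⁻ (map inj₁ xs) y∈
  ... | inj₂ y∈₂ with ∈-map⁻ inj₂ y∈₂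
  ...   | _ , y∈ys , refl = y∈ys
  ∈-⊕⁻ʳ y∈ | inj₁ y∈₁ with ∈-map⁻ inj₁ y∈₁
  ...   | _ , _ , ()

module _ {m n : ℕ} {G : OrientedGraph m} {H : OrientedGraph n} (f : Fin m → Fin n)
         (f-arc : ∀ {u v} → Arc G u v → Arc H (f u) (f v)) where

  reach≤2-map : ∀ {u v} → Reach≤2 G u v → Reach≤2 H (f u) (f v)
  reach≤2-map (inj₁ uv) = inj₁ (f-arc uv)
  reach≤2-map (inj₂ (w , uw , wv)) = inj₂ (f w , f-arc uw , f-arc wv)

  weakly-reach≤2-map : ∀ {u v} → Reach≤2 G u v ⊎ Reach≤2 G v u →
                       Reach≤2 H (f u) (f v) ⊎ Reach≤2 H (f v) (f u)
  weakly-reach≤2-map = Sum.map reach≤2-map reach≤2-map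

module _ {n : ℕ} where
  open MembershipDec (≡-dec (_≟_ {n}) (_≟_ {n})) using (_∈?_)

  noLoop? : (as : List (Fin n × Fin n)) → Dec (∀ u → ¬ (u , u) ∈ as)
  noLoop? as = all? λ u → ¬? ((u , u) ∈? as)

  no2cycle? : (as : List (Fin n × Fin n)) → Dec (∀ u v → (u , v) ∈ as → ¬ (v , u) ∈ as)
  no2cycle? as = all? λ u → all? λ v → ((u , v) ∈? as) →-dec ¬? ((v , u) ∈? as)

  reach≤2? : (G : OrientedGraph n) → ∀ u v → Dec (Reach≤2 G u v)
  reach≤2? G u v = ((u , v) ∈? arcs G) ⊎-dec any? λ w → ((u , w) ∈? arcs G) ×-dec ((w , v) ∈? arcs G)

  weakDiam≤2? : (G : OrientedGraph n) → Dec (WeakDiam≤2 G)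
  weakDiam≤2? G = all? λ u → all? λ v → ¬? (u ≟ v) →-dec (reach≤2? G u v ⊎-dec reach≤2? G v u)

  open UniqueDec (≡-dec (_≟_ {n}) (_≟_ {n})) public using (unique?)

Achievable : ℕ → ℕ → Set
Achievable n c = Σ (OrientedGraph n) λ G → WeakDiam≤2 G × numArcs G ≤ c

edgeless : ∀ n → OrientedGraph n
edgeless n = record { arcs = [] ; distinct = [] ; noLoop = λ _ () ; no2cycle = λ _ _ () }

achievable-0 : Achievable 0 0
achievable-0 = edgeless 0 , (λ ()) , z≤n

achievable-1 : Achievable 1 0
achievable-1 = edgeless 1 , (λ { 0F 0F 0≢0 → ⊥-elim (0≢0 refl) }) , z≤n

cycle₅ : OrientedGraph 5
cycle₅ = record
  { arcs     = five
  ; distinct = from-yes (unique? five)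
  ; noLoop   = from-yes (noLoop? five)
  ; no2cycle = from-yes (no2cycle? five)
  }
  where
  five : List (Fin 5 × Fin 5)
  five = (0F , 1F) ∷ (1F , 2F) ∷ (2F , 3F) ∷ (3F , 4F) ∷ (4F , 0F) ∷ []

achievable-5 : Achievable 5 5
achievable-5 = cycle₅ , from-yes (weakDiam≤2? cycle₅) , ≤-refl

module HubJoin {a b : ℕ} (G₁ : OrientedGraph a) (G₂ : OrientedGraph b) where

  Vertex : Set
  Vertex = Fin (suc (a + b))

  hub : Vertex
  hub = zero

  inl : Fin a → Vertex
  inl i = suc (i ↑ˡ b)

  inr : Fin b → Vertex
  inr j = suc (a ↑ʳ j)

  data Position : Vertex → Set where
    at-hub : Position hub
    at-inl : ∀ i → Position (inl i)
    at-inr : ∀ j → Position (inr j)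

  position : ∀ v → Position v
  position zero = at-hub
  position (suc k) with splitAt a k | join-splitAt a b k
  ... | inj₁ i | refl = at-inl i
  ... | inj₂ j | refl = at-inr j

  Slot : Set
  Slot = Maybe (Fin a ⊎ Fin b)

  slot : Vertex → Slot
  slot zero    = nothing
  slot (suc k) = just (splitAt a k)

  slots : Vertex × Vertex → Slot × Slot
  slots (u , v) = slot u , slot v

  slot-inl : ∀ i → slot (inl i) ≡ just (inj₁ i)
  slot-inl i = cong just (splitAt-↑ˡ a i b)

  slot-inr : ∀ j → slot (inr j) ≡ just (inj₂ j)
  slot-inr j = cong just (splitAt-↑ʳ a b j)

  -- Arcs of the join read off on slots, where the four kinds of arcs are told apart by unification.
  data HubArc : Slot × Slot → Set where
    inside₁ : ∀ {p q} → Arc G₁ p q → HubArc (just (inj₁ p) , just (inj₁ q))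
    inside₂ : ∀ {p q} → Arc G₂ p q → HubArc (just (inj₂ p) , just (inj₂ q))
    enter   : ∀ i → HubArc (just (inj₁ i) , nothing)
    leave   : ∀ j → HubArc (nothing , just (inj₂ j))

  hubArc-irrefl : ∀ {s} → ¬ HubArc (s , s)
  hubArc-irrefl (inside₁ pp) = noLoop G₁ _ pp
  hubArc-irrefl (inside₂ pp) = noLoop G₂ _ pp

  hubArc-asym : ∀ {s t} → HubArc (s , t) → ¬ HubArc (t , s)
  hubArc-asym (inside₁ pq) (inside₁ qp) = no2cycle G₁ _ _ pq qp
  hubArc-asym (inside₂ pq) (inside₂ qp) = no2cycle G₂ _ _ pq qp
  hubArc-asym (enter i) ()
  hubArc-asym (leave j) ()

  Code : Set
  Code = ((Fin a × Fin a) ⊎ (Fin b × Fin b)) ⊎ (Fin a ⊎ Fin b)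

  codes : List Code
  codes = (arcs G₁ ⊕ arcs G₂) ⊕ (allFin a ⊕ allFin b)

  arcOf : Code → Vertex × Vertex
  arcOf (inj₁ (inj₁ (p , q))) = inl p , inl q
  arcOf (inj₁ (inj₂ (p , q))) = inr p , inr q
  arcOf (inj₂ (inj₁ i))       = inl i , hub
  arcOf (inj₂ (inj₂ j))       = hub , inr j

  slotsOf : Code → Slot × Slot
  slotsOf (inj₁ (inj₁ (p , q))) = just (inj₁ p) , just (inj₁ q)
  slotsOf (inj₁ (inj₂ (p , q))) = just (inj₂ p) , just (inj₂ q)
  slotsOf (inj₂ (inj₁ i))       = just (inj₁ i) , nothing
  slotsOf (inj₂ (inj₂ j))       = nothing , just (inj₂ j)

  codeOf : Slot × Slot → Maybe Code
  codeOf (just (inj₁ p) , just (inj₁ q)) = just (inj₁ (inj₁ (p , q)))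
  codeOf (just (inj₂ p) , just (inj₂ q)) = just (inj₁ (inj₂ (p , q)))
  codeOf (just (inj₁ i) , nothing)       = just (inj₂ (inj₁ i))
  codeOf (nothing , just (inj₂ j))       = just (inj₂ (inj₂ j))
  codeOf _                               = nothing

  codeOf-slotsOf : ∀ c → codeOf (slotsOf c) ≡ just c
  codeOf-slotsOf (inj₁ (inj₁ _)) = refl
  codeOf-slotsOf (inj₁ (inj₂ _)) = refl
  codeOf-slotsOf (inj₂ (inj₁ _)) = refl
  codeOf-slotsOf (inj₂ (inj₂ _)) = refl

  slots-arcOf : ∀ c → slots (arcOf c) ≡ slotsOf c
  slots-arcOf (inj₁ (inj₁ (p , q))) = cong₂ _,_ (slot-inl p) (slot-inl q)
  slots-arcOf (inj₁ (inj₂ (p , q))) = cong₂ _,_ (slot-inr p) (slot-inr q)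
  slots-arcOf (inj₂ (inj₁ i))       = cong (_, nothing) (slot-inl i)
  slots-arcOf (inj₂ (inj₂ j))       = cong (nothing ,_) (slot-inr j)

  arcOf-injective : Injective _≡_ _≡_ arcOf
  arcOf-injective {c} {c′} eq = just-injective (begin
    just c                     ≡⟨ codeOf-slotsOf c ⟨
    codeOf (slotsOf c)         ≡⟨ cong codeOf (slots-arcOf c) ⟨
    codeOf (slots (arcOf c))   ≡⟨ cong (codeOf ∘ slots) eq ⟩
    codeOf (slots (arcOf c′))  ≡⟨ cong codeOf (slots-arcOf c′) ⟩
    codeOf (slotsOf c′)        ≡⟨ codeOf-slotsOf c′ ⟩
    just c′                    ∎)
    where open ≡-Reasoning

  code-hubArc : ∀ {c} → c ∈ codes → HubArc (slotsOf c)
  code-hubArc {inj₁ (inj₁ _)} c∈ = inside₁ (∈-⊕⁻ˡ (∈-⊕⁻ˡ c∈))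
  code-hubArc {inj₁ (inj₂ _)} c∈ = inside₂ (∈-⊕⁻ʳ {xs = arcs G₁} (∈-⊕⁻ˡ c∈))
  code-hubArc {inj₂ (inj₁ i)} _  = enter i
  code-hubArc {inj₂ (inj₂ j)} _  = leave j

  hubArcs : List (Vertex × Vertex)
  hubArcs = map arcOf codes

  arc-hubArc : ∀ {u v} → (u , v) ∈ hubArcs → HubArc (slot u , slot v)
  arc-hubArc uv∈ with ∈-map⁻ arcOf uv∈
  ... | c , c∈ , eq = subst HubArc (sym (trans (cong slots eq) (slots-arcOf c))) (code-hubArc c∈)

  hubJoin : OrientedGraph (suc (a + b))
  hubJoin = record
    { arcs     = hubArcs
    ; distinct = map⁺ arcOf-injective (⊕-unique (⊕-unique (distinct G₁) (distinct G₂))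
                                                 (⊕-unique (allFin⁺ a) (allFin⁺ b)))
    ; noLoop   = λ u uu∈ → hubArc-irrefl (arc-hubArc uu∈)
    ; no2cycle = λ u v uv∈ vu∈ → hubArc-asym (arc-hubArc uv∈) (arc-hubArc vu∈)
    }

  inl-arc : ∀ {p q} → Arc G₁ p q → Arc hubJoin (inl p) (inl q)
  inl-arc pq = ∈-map⁺ arcOf (∈-⊕⁺ˡ (∈-⊕⁺ˡ pq))

  inr-arc : ∀ {p q} → Arc G₂ p q → Arc hubJoin (inr p) (inr q)
  inr-arc pq = ∈-map⁺ arcOf (∈-⊕⁺ˡ (∈-⊕⁺ʳ {xs = arcs G₁} pq))

  enter-arc : ∀ i → Arc hubJoin (inl i) hub
  enter-arc i = ∈-map⁺ arcOf (∈-⊕⁺ʳ (∈-⊕⁺ˡ (∈-allFin i)))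

  leave-arc : ∀ j → Arc hubJoin hub (inr j)
  leave-arc j = ∈-map⁺ arcOf (∈-⊕⁺ʳ (∈-⊕⁺ʳ {xs = allFin a} (∈-allFin j)))

  hubJoin-weakDiam≤2 : WeakDiam≤2 G₁ → WeakDiam≤2 G₂ → WeakDiam≤2 hubJoin
  hubJoin-weakDiam≤2 d₁ d₂ u v u≢v = reach (position u) (position v) u≢v
    where
    reach : ∀ {u v} → Position u → Position v → u ≢ v → Reach≤2 hubJoin u v ⊎ Reach≤2 hubJoin v u
    reach at-hub     at-hub     h≢h = ⊥-elim (h≢h refl)
    reach at-hub     (at-inl i) _   = inj₂ (inj₁ (enter-arc i))
    reach at-hub     (at-inr j) _   = inj₁ (inj₁ (leave-arc j))
    reach (at-inl i) at-hub     _   = inj₁ (inj₁ (enter-arc i))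
    reach (at-inl i) (at-inl p) i≢p =
      weakly-reach≤2-map {G = G₁} {H = hubJoin} inl inl-arc (d₁ i p (i≢p ∘ cong inl))
    reach (at-inl i) (at-inr j) _   = inj₁ (inj₂ (hub , enter-arc i , leave-arc j))
    reach (at-inr j) at-hub     _   = inj₂ (inj₁ (leave-arc j))
    reach (at-inr j) (at-inl i) _   = inj₂ (inj₂ (hub , enter-arc i , leave-arc j))
    reach (at-inr j) (at-inr q) j≢q =
      weakly-reach≤2-map {G = G₂} {H = hubJoin} inr inr-arc (d₂ j q (j≢q ∘ cong inr))

  numArcs-hubJoin : numArcs hubJoin ≡ (numArcs G₁ + numArcs G₂) + (a + b)
  numArcs-hubJoin = begin
    length (map arcOf codes)
      ≡⟨ length-map arcOf codes ⟩
    length ((arcs G₁ ⊕ arcs G₂) ⊕ (allFin a ⊕ allFin b))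
      ≡⟨ length-⊕ (arcs G₁ ⊕ arcs G₂) (allFin a ⊕ allFin b) ⟩
    length (arcs G₁ ⊕ arcs G₂) + length (allFin a ⊕ allFin b)
      ≡⟨ cong₂ _+_ (length-⊕ (arcs G₁) (arcs G₂)) (length-⊕ (allFin a) (allFin b)) ⟩
    (numArcs G₁ + numArcs G₂) + (length (allFin a) + length (allFin b))
      ≡⟨ cong ((numArcs G₁ + numArcs G₂) +_) (cong₂ _+_ (length-tabulate {n = a} id) (length-tabulate {n = b} id)) ⟩
    (numArcs G₁ + numArcs G₂) + (a + b)
      ∎
    where open ≡-Reasoning

hubJoin-achievable : ∀ {a b c₁ c₂} → Achievable a c₁ → Achievable b c₂ →
                     Achievable (suc (a + b)) ((c₁ + c₂) + (a + b))
hubJoin-achievable (G₁ , d₁ , G₁≤) (G₂ , d₂ , G₂≤) =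
  hubJoin ,
  hubJoin-weakDiam≤2 d₁ d₂ ,
  subst (_≤ _) (sym numArcs-hubJoin) (+-mono-≤ (+-mono-≤ G₁≤ G₂≤) ≤-refl)
  where open HubJoin G₁ G₂

t+t≡t*2 : ∀ t → t + t ≡ t * 2
t+t≡t*2 t = sym (trans (*-comm t 2) (cong (t +_) (+-identityʳ t)))

t*2/2≡t : ∀ t → t * 2 / 2 ≡ t
t*2/2≡t t = m*n/n≡m t 2

halves-double : ∀ t → 0 < t → suc ((t * 2) / 2 + (t * 2 ∸ 2) / 2) ≡ t * 2
halves-double (suc t) _ rewrite t*2/2≡t (suc t) | t*2/2≡t t = cong (2 +_) (t+t≡t*2 t)

halves-double+1 : ∀ t → suc ((1 + t * 2 ∸ 1) / 2 + (1 + t * 2 ∸ 1) / 2) ≡ 1 + t * 2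
halves-double+1 t rewrite t*2/2≡t t = cong suc (t+t≡t*2 t)

halves-double+1′ : ∀ t → 0 < t → suc ((1 + t * 2 + 1) / 2 + (1 + t * 2 ∸ 3) / 2) ≡ 1 + t * 2
halves-double+1′ (suc t) _ = begin
  suc ((3 + t * 2 + 1) / 2 + (t * 2) / 2) ≡⟨ cong (λ m → suc (m / 2 + (t * 2) / 2)) (+-comm (3 + t * 2) 1) ⟩
  suc ((2 + t) * 2 / 2 + (t * 2) / 2)     ≡⟨ cong suc (cong₂ _+_ (t*2/2≡t (2 + t)) (t*2/2≡t t)) ⟩
  3 + (t + t)                             ≡⟨ cong (3 +_) (t+t≡t*2 t) ⟩
  3 + t * 2                               ∎
  where open ≡-Reasoning

module _ {n : ℕ} where

  ≡%2+[/2]*2 : ∀ {r} → n % 2 ≡ r → n ≡ r + (n / 2) * 2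
  ≡%2+[/2]*2 n%2≡r = trans (m≡m%n+[m/n]*n n 2) (cong (_+ (n / 2) * 2) n%2≡r)

  even-halves : n % 2 ≡ 0 → 2 ≤ n → suc (n / 2 + (n ∸ 2) / 2) ≡ n
  even-halves even 2≤n =
    subst (λ m → suc (m / 2 + (m ∸ 2) / 2) ≡ m) (sym (≡%2+[/2]*2 even)) (halves-double (n / 2) (m≥n⇒m/n>0 2≤n))

  odd-halves : n % 2 ≡ 1 → suc ((n ∸ 1) / 2 + (n ∸ 1) / 2) ≡ n
  odd-halves odd =
    subst (λ m → suc ((m ∸ 1) / 2 + (m ∸ 1) / 2) ≡ m) (sym (≡%2+[/2]*2 odd)) (halves-double+1 (n / 2))

  odd-halves′ : n % 2 ≡ 1 → 2 ≤ n → suc ((n + 1) / 2 + (n ∸ 3) / 2) ≡ n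
  odd-halves′ odd 2≤n =
    subst (λ m → suc ((m + 1) / 2 + (m ∸ 3) / 2) ≡ m) (sym (≡%2+[/2]*2 odd)) (halves-double+1′ (n / 2) (m≥n⇒m/n>0 2≤n))

  %4⇒%2 : ∀ {r} → n % 4 ≡ r → n % 2 ≡ r % 2
  %4⇒%2 n%4≡r = trans (sym (m∣n⇒o%n%m≡o%m 2 4 n (divides 2 refl))) (cong (_% 2) n%4≡r)

xf-step : ∀ k m → ∃₂ λ A B → 6 + m ≡ suc (A + B) × xf (suc k) (6 + m) ≡ (5 + m) + (xf k A + xf k B)
xf-step k m with (6 + m) % 4 in n%4
... | 0 = _ , _ , sym (even-halves (%4⇒%2 {6 + m} n%4) (s≤s (s≤s z≤n))) , refl
... | 1 = _ , _ , sym (odd-halves′ (%4⇒%2 {6 + m} n%4) (s≤s (s≤s z≤n))) , refl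
... | 2 = _ , _ , sym (even-halves (%4⇒%2 {6 + m} n%4) (s≤s (s≤s z≤n))) , refl
-- here xf unfolds 2 * xf k h to xf k h + (xf k h + 0)
... | 3 = _ , _ , sym (odd-halves (%4⇒%2 {6 + m} n%4)) , cong (λ y → 5 + m + (xf k h + y)) (+-identityʳ (xf k h))
  where h = (5 + m) / 2
... | suc (suc (suc (suc r))) =
  ⊥-elim (<⇒≱ (m%n<n (6 + m) 4) (subst (4 ≤_) (sym n%4) (s≤s (s≤s (s≤s (s≤s z≤n))))))

achievable-split : ∀ {n A B c₁ c₂} → n ≡ suc (A + B) → Achievable A c₁ → Achievable B c₂ →
                   Achievable n ((n ∸ 1) + (c₁ + c₂))
achievable-split {A = A} {B} {c₁} {c₂} refl G₁ G₂ =
  subst (Achievable _) (+-comm (c₁ + c₂) (A + B)) (hubJoin-achievable G₁ G₂)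

achievable-xf : ∀ k n → n ≤ k → Achievable n (xf k n)
achievable-xf zero    zero _ = achievable-0
achievable-xf (suc k) 0    _ = achievable-0
achievable-xf (suc k) 1    _ = achievable-1
achievable-xf (suc k) 2    _ = hubJoin-achievable achievable-1 achievable-0
achievable-xf (suc k) 3    _ = hubJoin-achievable achievable-1 achievable-1
achievable-xf (suc k) 4    _ = hubJoin-achievable (hubJoin-achievable achievable-1 achievable-0) achievable-1
achievable-xf (suc k) 5    _ = achievable-5
achievable-xf (suc k) (suc (suc (suc (suc (suc (suc m)))))) n≤ with xf-step k m
... | A , B , n≡ , x≡ =
  subst (Achievable (6 + m)) (sym x≡)
    (achievable-split n≡ (achievable-xf k A (≤-trans (m≤m+n A B) A+B≤k))
                         (achievable-xf k B (≤-trans (m≤n+m B A) A+B≤k)))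
  where
  A+B≤k : A + B ≤ k
  A+B≤k = s≤s⁻¹ (subst (_≤ suc k) n≡ n≤)

theorem6 : (n : ℕ) → 1 ≤ n → Σ (OrientedGraph n) (λ G → WeakDiam≤2 G × numArcs G ≤ x n)
theorem6 n _ = achievable-xf n n ≤-refl
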